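{- Let $(G,\pi,P)$ be an online graph with predictions, where $G$ is a finite simple graph. If \textsc{FirstFitPredictions} uses $x(G)$ distinct colors on $(G,\pi,P)$ (the algorithm having no knowledge of $\chi(G)$), then $x(G)\le \eta(G)+\chi(G)$.
   Context: An online graph with predictions $(G,\pi,P)$ consists of a graph $G=(V,E)$, an ordering $\pi=v_1,\dots,v_n$ of $V$ in which vertices are revealed one by one (with their adjacencies to previously revealed vertices), and a prediction map $P:V\to\mathcal{U}$, where $\mathcal{U}$ is the (infinite) universe of colors; $P(v)$ is revealed together with $v$. Colors must be assigned irrevocably upon arrival and the coloring must be proper. $\chi(G)$ is the chromatic number. Let $\mathcal{O}(G)$ be the set of proper colorings $O:V\to\mathcal{U}$ of $G$ using exactly $\chi(G)$ colors; the prediction error is $\eta(G)=\min_{O\in\mathcal{O}(G)}|\{v\in V: P(v)\neq O(v)\}|$. Algorithm \textsc{FirstFitPredictions}: for each predicted color $c$ there is an associated palette $C(c)=\{c^0,c^1,c^2,\dots\}$ ordered by superscript, with the palettes of distinct predicted colors pairwise disjoint; when a vertex $v$ with $P(v)=c$ arrives, it receives the color of smallest superscript in $C(c)$ that is not assigned to any previously revealed neighbor of $v$. (Equivalently, it runs \textsc{FirstFit} — assign the smallest color not used by an earlier neighbor — separately on each subgraph induced by the vertices sharing the same prediction, with disjoint palettes.) -}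

module Defs where

open import Data.Nat using (ℕ; zero; suc; _+_; _≤_)
import Data.Nat.Properties as ℕP
open import Data.Bool using (Bool; true; false; if_then_else_)
open import Data.Fin using (Fin)
import Data.Fin.Properties as FinP
open import Data.Fin.Permutation using (Permutation′; _⟨$⟩ʳ_)
open import Data.List using (List; []; _∷_; _++_; map; length; filter; deduplicate; [_])
open import Data.List.Membership.DecPropositional ℕP._≟_ using (_∈?_)
open import Data.List.Base using (allFin)
open import Data.Product using (_×_; _,_; proj₁; proj₂; Σ)
open import Data.Product.Properties using (≡-dec)
open import Relation.Binary.PropositionalEquality using (_≡_; _≢_)
open import Relation.Nullary using (yes; no; does)
open import Relation.Nullary.Decidable using (⌊_⌋)
open import Data.Bool using (_∧_)

record SimpleGraph (n : ℕ) : Set where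
  field
    adj   : Fin n → Fin n → Bool
    sym   : ∀ u v → adj u v ≡ adj v u
    irrefl : ∀ v → adj v v ≡ false
open SimpleGraph public

distinctℕ : List ℕ → ℕ
distinctℕ xs = length (deduplicate ℕP._≟_ xs)

IsProper : ∀ {n} → SimpleGraph n → (Fin n → ℕ) → Set
IsProper G O = ∀ u v → adj G u v ≡ true → O u ≢ O v

colorsUsed : ∀ {n} → (Fin n → ℕ) → ℕ
colorsUsed {n} O = distinctℕ (map O (allFin n))

IsChromaticNumber : ∀ {n} → SimpleGraph n → ℕ → Set
IsChromaticNumber G k =
  Σ (_ → ℕ) (λ O → IsProper G O × colorsUsed O ≡ k)
  × (∀ O → IsProper G O → k ≤ colorsUsed O)

mismatches : ∀ {n} → (Fin n → ℕ) → (Fin n → ℕ) → ℕ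
mismatches {n} P O = length (filter (λ v → Relation.Nullary.¬? (P v ℕP.≟ O v)) (allFin n))
  where import Relation.Nullary

-- FirstFitPredictions.
-- A color of the output is a pair (c , k) standing for c^k: the k-th color
-- of the palette C(c) of predicted color c.  Palettes of distinct c are
-- disjoint, as required.

Color : Set
Color = ℕ × ℕ

mexFrom : ℕ → ℕ → List ℕ → ℕ
mexFrom zero     k xs = k
mexFrom (suc f) k xs = if does (k ∈? xs) then mexFrom f (suc k) xs else k

-- smallest natural number not in xs (fuel length xs + 1 suffices)
mex : List ℕ → ℕ
mex xs = mexFrom (suc (length xs)) 0 xs

module FirstFitPredictions {n : ℕ} (G : SimpleGraph n) (P : Fin n → ℕ) where

  -- superscripts already used on earlier neighbours of v sharing v's prediction
  -- (colors are (P u , k) so only those in palette C(P v) can conflict)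
  blocked : List (Fin n × Color) → Fin n → List ℕ
  blocked [] v = []
  blocked ((u , (c , k)) ∷ h) v =
    if adj G u v ∧ ⌊ c ℕP.≟ P v ⌋ then k ∷ blocked h v else blocked h v

  step : List (Fin n × Color) → Fin n → Color
  step h v = (P v , mex (blocked h v))

  run : List (Fin n × Color) → List (Fin n) → List (Fin n × Color)
  run h []       = h
  run h (v ∷ vs) = run (h ++ [ (v , step h v) ]) vs

arrivalOrder : ∀ {n} → Permutation′ n → List (Fin n)
arrivalOrder {n} π = map (π ⟨$⟩ʳ_) (allFin n)

ffpColors : ∀ {n} → SimpleGraph n → Permutation′ n → (Fin n → ℕ) → ℕ
ffpColors G π P =
  length (deduplicate (≡-dec ℕP._≟_ ℕP._≟_)
    (map proj₂ (FirstFitPredictions.run G P [] (arrivalOrder π))))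

{-# OPTIONS --safe #-}
-- Fix a proper coloring O and call v correctly predicted when P v = O v.  Incorrectly predicted
-- vertices account for at most mismatches P O colors.  A correctly predicted vertex gets a color
-- from the palette of c = O v, and in that palette only the topmost superscript reached by a correctly
-- predicted vertex can be new: First-Fit gave every lower superscript of the palette to an earlier
-- neighbour with the same prediction c, and properness of O forbids that neighbour to be correctly
-- predicted.  This leaves at most one further color per color class of O.
module Submission where

open import Defs hiding (sym)
open import Data.Nat using (ℕ; zero; suc; _+_; _≤_; _<_; z≤n; s≤s)
open import Data.Nat.Properties using (_≟_; _<?_; <⇒≱; ≤∧≢⇒<; ≮⇒≥; +-monoˡ-≤; module ≤-Reasoning)
open import Data.Fin using (Fin)
open import Data.Fin.Permutation using (Permutation′; _⟨$⟩ʳ_; _⟨$⟩ˡ_; inverseˡ)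
open import Data.List using (List; []; _∷_; _++_; [_]; map; length; filter; deduplicate; allFin)
open import Data.List.Properties
  using (length-++; length-map; length-removeAt′; ++-identityʳ; ++-assoc; map-++)
open import Data.List.Extrema.Nat using (max; max≈v⁺)
open import Data.List.Membership.Propositional using (_∈_; find)
open import Data.List.Membership.DecPropositional _≟_ using (_∈?_)
open import Data.List.Membership.Propositional.Properties
  using ( ∈-map⁺; ∈-map⁻; ∈-filter⁺; ∈-filter⁻; ∈-++⁺ˡ; ∈-++⁺ʳ; ∈-++⁻; ∈-allFin
        ; ∈-deduplicate⁺; ∈-deduplicate⁻)
open import Data.List.Relation.Binary.Subset.Propositional using (_⊆_)
open import Data.List.Relation.Binary.Subset.Propositional.Properties using (filter⁺′)
open import Data.List.Relation.Unary.Any using (here; there; any?; _─_)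
import Data.List.Relation.Unary.All as All
open import Data.List.Relation.Unary.All.Properties using (¬Any⇒All¬)
import Data.List.Relation.Unary.All.Properties as All
open import Data.List.Relation.Unary.Unique.Propositional using (Unique; _∷_)
import Data.List.Relation.Unary.Unique.Propositional.Properties as Unique
open import Data.List.Relation.Unary.Unique.DecPropositional.Properties using (deduplicate-!)
open import Data.Product using (_×_; _,_; proj₁; proj₂; ∃-syntax)
open import Data.Product.Properties using (≡-dec)
open import Data.Sum using (inj₁; inj₂)
open import Data.Empty using (⊥-elim)
open import Data.Bool using (true; false)
open import Function using (_∘_; id)
open import Relation.Nullary using (yes; no; does; ¬?; _×-dec_)
open import Relation.Unary using (Pred; Decidable)
open import Relation.Binary.Definitions using (DecidableEquality)
open import Relation.Binary.PropositionalEquality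
  using (_≡_; _≢_; refl; sym; trans; cong; cong₂; subst; module ≡-Reasoning)

module _ {A : Set} where

  ∈-─⁺ : ∀ {x z : A} {ys} (x∈ys : x ∈ ys) → z ∈ ys → x ≢ z → z ∈ (ys ─ x∈ys)
  ∈-─⁺ (here refl) (here refl) x≢z = ⊥-elim (x≢z refl)
  ∈-─⁺ (here _)    (there z∈)  _   = z∈
  ∈-─⁺ (there _)   (here z≡)   _   = here z≡
  ∈-─⁺ (there x∈)  (there z∈)  x≢z = there (∈-─⁺ x∈ z∈ x≢z)

  Unique-⊆⇒length≤ : ∀ {xs ys : List A} → Unique xs → xs ⊆ ys → length xs ≤ length ys
  Unique-⊆⇒length≤ {[]}     _            _     = z≤n
  Unique-⊆⇒length≤ {x ∷ xs} {ys} (x∉xs ∷ u) xs⊆ys = begin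
    suc (length xs)               ≤⟨ s≤s (Unique-⊆⇒length≤ u xs⊆ys─x) ⟩
    suc (length (ys ─ x∈ys))      ≡⟨ sym (length-removeAt′ ys _) ⟩
    length ys                     ∎
    where
      open ≤-Reasoning
      x∈ys : x ∈ ys
      x∈ys = xs⊆ys (here refl)
      xs⊆ys─x : xs ⊆ (ys ─ x∈ys)
      xs⊆ys─x z∈xs = ∈-─⁺ x∈ys (xs⊆ys (there z∈xs)) (All.lookup x∉xs z∈xs)

map-filter : ∀ {A B : Set} {p} {P : Pred B p} (f : A → B) (P? : Decidable P) xs →
             map f (filter (P? ∘ f) xs) ≡ filter P? (map f xs)
map-filter f P? []       = refl
map-filter f P? (x ∷ xs) with does (P? (f x))
... | true  = cong (f x ∷_) (map-filter f P? xs)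
... | false = map-filter f P? xs

<mexFrom⇒∈ : ∀ fuel k xs {j} → k ≤ j → j < mexFrom fuel k xs → j ∈ xs
<mexFrom⇒∈ zero       k xs k≤j j<mex = ⊥-elim (<⇒≱ j<mex k≤j)
<mexFrom⇒∈ (suc fuel) k xs {j} k≤j j<mex with k ∈? xs
... | no _  = ⊥-elim (<⇒≱ j<mex k≤j)
... | yes k∈xs with k ≟ j
...   | yes refl = k∈xs
...   | no k≢j   = <mexFrom⇒∈ fuel (suc k) xs (≤∧≢⇒< k≤j k≢j) j<mex

<mex⇒∈ : ∀ xs {j} → j < mex xs → j ∈ xs
<mex⇒∈ xs = <mexFrom⇒∈ (suc (length xs)) 0 xs z≤n

module FirstFitPredictionsProperties {n} (G : SimpleGraph n) (P : Fin n → ℕ) where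
  open FirstFitPredictions G P

  History : Set
  History = List (Fin n × Color)

  superscript : Fin n × Color → ℕ
  superscript = proj₂ ∘ proj₂

  ∈-blocked⁻ : ∀ h v {k} → k ∈ blocked h v → ∃[ w ] (w , (P v , k)) ∈ h × adj G w v ≡ true
  ∈-blocked⁻ ((u , (c , k′)) ∷ h) v k∈ with adj G u v in u~v | c ≟ P v
  ∈-blocked⁻ ((u , (c , k′)) ∷ h) v (here refl) | true  | yes refl = u , here refl , u~v
  ∈-blocked⁻ ((u , (c , k′)) ∷ h) v (there k∈)  | true  | yes _    =
    let w , w∈ , w~v = ∈-blocked⁻ h v k∈ in w , there w∈ , w~v
  ∈-blocked⁻ ((u , (c , k′)) ∷ h) v k∈          | true  | no _     =
    let w , w∈ , w~v = ∈-blocked⁻ h v k∈ in w , there w∈ , w~v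
  ∈-blocked⁻ ((u , (c , k′)) ∷ h) v k∈          | false | _        =
    let w , w∈ , w~v = ∈-blocked⁻ h v k∈ in w , there w∈ , w~v

  data Reachable : History → Set where
    []  : Reachable []
    _∷ʳ_ : ∀ {h} → Reachable h → ∀ v → Reachable (h ++ [ (v , step h v) ])

  reachable-run : ∀ {h} vs → Reachable h → Reachable (run h vs)
  reachable-run []       r = r
  reachable-run (v ∷ vs) r = reachable-run vs (r ∷ʳ v)

  run-vertices : ∀ h vs → map proj₁ (run h vs) ≡ map proj₁ h ++ vs
  run-vertices h []       = sym (++-identityʳ (map proj₁ h))
  run-vertices h (v ∷ vs) = begin
    map proj₁ (run (h ++ [ (v , step h v) ]) vs)  ≡⟨ run-vertices _ vs ⟩
    map proj₁ (h ++ [ (v , step h v) ]) ++ vs     ≡⟨ cong (_++ vs) (map-++ proj₁ h _) ⟩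
    (map proj₁ h ++ [ v ]) ++ vs                  ≡⟨ ++-assoc (map proj₁ h) [ v ] vs ⟩
    map proj₁ h ++ v ∷ vs                         ∎
    where open ≡-Reasoning

  computedBy-step : ∀ {h v col} → Reachable h → (v , col) ∈ h →
                    ∃[ pre ] pre ⊆ h × col ≡ step pre v
  computedBy-step (_∷ʳ_ {h} r v) e∈ with ∈-++⁻ h e∈
  ... | inj₁ e∈h = let pre , pre⊆h , eq = computedBy-step r e∈h in pre , ∈-++⁺ˡ ∘ pre⊆h , eq
  ... | inj₂ (here refl) = h , ∈-++⁺ˡ , refl

  palette≡prediction : ∀ {h v c k} → Reachable h → (v , (c , k)) ∈ h → c ≡ P v
  palette≡prediction r e∈ = cong proj₁ (proj₂ (proj₂ (computedBy-step r e∈)))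

  firstFit-below : ∀ {h u c k j} → Reachable h → (u , (c , k)) ∈ h → j < k →
                   ∃[ w ] (w , (c , j)) ∈ h × adj G w u ≡ true
  firstFit-below r u∈ j<k with computedBy-step r u∈
  ... | pre , pre⊆h , refl =
    let w , w∈ , w~u = ∈-blocked⁻ pre _ (<mex⇒∈ _ j<k) in w , pre⊆h w∈ , w~u

module AgainstProperColoring {n} (G : SimpleGraph n) (P O : Fin n → ℕ) (O-proper : IsProper G O) where
  open FirstFitPredictions G P
  open FirstFitPredictionsProperties G P

  incorrect? : Decidable (λ v → P v ≢ O v)
  incorrect? v = ¬? (P v ≟ O v)

  incorrectColors : History → List Color
  incorrectColors h = map proj₂ (filter (incorrect? ∘ proj₁) h)

  correctIn? : (c : ℕ) → Decidable (λ ((v , (c′ , _)) : Fin n × Color) → P v ≡ O v × c′ ≡ c)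
  correctIn? c (v , (c′ , _)) = (P v ≟ O v) ×-dec (c′ ≟ c)

  top : ℕ → History → ℕ
  top c h = max 0 (map superscript (filter (correctIn? c) h))

  topColors : History → List Color
  topColors h = map (λ c → c , top c h) (deduplicate _≟_ (map O (allFin n)))

  below-correct⇒incorrectColor : ∀ {h u c k j} → Reachable h → (u , (c , k)) ∈ h → P u ≡ O u →
                                  j < k → (c , j) ∈ incorrectColors h
  below-correct⇒incorrectColor {u = u} {c} r u∈ u-correct j<k with firstFit-below r u∈ j<k
  ... | w , w∈ , w~u = ∈-map⁺ proj₂ (∈-filter⁺ (incorrect? ∘ proj₁) w∈ w-incorrect)
    where
      w-incorrect : P w ≢ O w
      w-incorrect w-correct = O-proper w u w~u (begin
        O w ≡⟨ sym w-correct ⟩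
        P w ≡⟨ sym (palette≡prediction r w∈) ⟩
        c   ≡⟨ palette≡prediction r u∈ ⟩
        P u ≡⟨ u-correct ⟩
        O u ∎)
        where open ≡-Reasoning

  colors⊆ : ∀ {h} → Reachable h → map proj₂ h ⊆ incorrectColors h ++ topColors h
  colors⊆ {h} r col∈ with ∈-map⁻ proj₂ col∈
  ... | (v , (c , k)) , v∈ , refl with P v ≟ O v
  ...   | no v-incorrect = ∈-++⁺ˡ (∈-map⁺ proj₂ (∈-filter⁺ (incorrect? ∘ proj₁) v∈ v-incorrect))
  ...   | yes v-correct with any? (λ e → k <? superscript e) (filter (correctIn? c) h)
  ...     | yes above with find above
  ...       | (u , (_ , k′)) , u∈ , k<k′ with ∈-filter⁻ (correctIn? c) u∈
  ...         | u∈h , u-correct , refl = ∈-++⁺ˡ (below-correct⇒incorrectColor r u∈h u-correct k<k′)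
  colors⊆ {h} r col∈ | (v , (c , k)) , v∈ , refl | yes v-correct | no none =
    ∈-++⁺ʳ (incorrectColors h) (subst (λ k′ → (c , k′) ∈ topColors h) top≡k
      (∈-map⁺ (λ c → c , top c h) (∈-deduplicate⁺ _≟_ c∈image)))
    where
      c∈image : c ∈ map O (allFin n)
      c∈image = subst (_∈ map O (allFin n)) (sym (trans (palette≡prediction r v∈) v-correct))
                      (∈-map⁺ O (∈-allFin v))
      top≡k : top c h ≡ k
      top≡k = max≈v⁺ (∈-map⁺ superscript (∈-filter⁺ (correctIn? c) v∈ (v-correct , refl)))
                     (All.map⁺ (All.map ≮⇒≥ (¬Any⇒All¬ _ none))) z≤n

  length-incorrectColors-run : ∀ vs →
                                length (incorrectColors (run [] vs)) ≡ length (filter incorrect? vs)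
  length-incorrectColors-run vs = begin
    length (map proj₂ wrong)                  ≡⟨ length-map proj₂ wrong ⟩
    length wrong                              ≡⟨ sym (length-map proj₁ wrong) ⟩
    length (map proj₁ wrong)                  ≡⟨ cong length (map-filter proj₁ incorrect? h) ⟩
    length (filter incorrect? (map proj₁ h))  ≡⟨ cong (length ∘ filter incorrect?) (run-vertices [] vs) ⟩
    length (filter incorrect? vs)             ∎
    where
      open ≡-Reasoning
      h : History
      h = run [] vs
      wrong : History
      wrong = filter (incorrect? ∘ proj₁) h

  length-topColors : ∀ h → length (topColors h) ≡ colorsUsed O
  length-topColors h = length-map (λ c → c , top c h) (deduplicate _≟_ (map O (allFin n)))

  length-filter-incorrect≤mismatches : ∀ {vs} → Unique vs →
                                       length (filter incorrect? vs) ≤ mismatches P O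
  length-filter-incorrect≤mismatches {vs} u = Unique-⊆⇒length≤ (Unique.filter⁺ incorrect? u)
    (filter⁺′ incorrect? incorrect? id {vs} {allFin n} (λ {v} _ → ∈-allFin v))

arrivalOrder-unique : ∀ {n} (π : Permutation′ n) → Unique (arrivalOrder π)
arrivalOrder-unique {n} π = Unique.map⁺ π-injective (Unique.allFin⁺ n)
  where
    π-injective : ∀ {i j} → π ⟨$⟩ʳ i ≡ π ⟨$⟩ʳ j → i ≡ j
    π-injective {i} {j} eq = trans (sym (inverseˡ π)) (trans (cong (π ⟨$⟩ˡ_) eq) (inverseˡ π))

theorem2 : ∀ {n} (G : SimpleGraph n) (π : Permutation′ n) (P : Fin n → ℕ) (χ : ℕ) →
    IsChromaticNumber G χ →
    ∀ (O : Fin n → ℕ) → IsProper G O → colorsUsed O ≡ χ →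
    ffpColors G π P ≤ mismatches P O + χ
theorem2 {n} G π P _ _ O O-proper refl = begin
  ffpColors G π P
    ≤⟨ Unique-⊆⇒length≤ (deduplicate-! ≟-color _)
                        (colors⊆ reachable ∘ ∈-deduplicate⁻ ≟-color _) ⟩
  length (incorrectColors h ++ topColors h)
    ≡⟨ length-++ (incorrectColors h) ⟩
  length (incorrectColors h) + length (topColors h)
    ≡⟨ cong₂ _+_ (length-incorrectColors-run vs) (length-topColors h) ⟩
  length (filter incorrect? vs) + colorsUsed O
    ≤⟨ +-monoˡ-≤ (colorsUsed O) (length-filter-incorrect≤mismatches {vs} (arrivalOrder-unique π)) ⟩
  mismatches P O + colorsUsed O ∎
  where
    open ≤-Reasoning
    open FirstFitPredictions G P using (run)
    open FirstFitPredictionsProperties G P using (Reachable; reachable-run)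
    open AgainstProperColoring G P O O-proper
    ≟-color : DecidableEquality Color
    ≟-color = ≡-dec _≟_ _≟_
    vs : List (Fin n)
    vs = arrivalOrder π
    h : List (Fin n × Color)
    h = run [] vs
    reachable : Reachable h
    reachable = reachable-run vs Reachable.[]
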